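{- For $r\ge 2$, as formal power series in $t$, \[\sum_{n\ge 0}V_n^{(r)}(x,y)\frac{t^n}{n!}=(1-t^r)^{\frac{x-y}{r}}(1-t)^{ -x}.\]
   Context: Fix an integer $r\ge 2$ and indeterminates $x,y$. For $n\ge 1$ let $A_n^{(r)}(x,y)=(a_{i,j})_{1\le i,j\le n}$ be the $n\times n$ matrix with $a_{i,i+1}=-i$ for $1\le i\le n-1$; $a_{i,j}=x$ whenever $0\le i-j\le r-2$; $a_{i,i-r+1}=y+i-r$ for $r\le i\le n$; and all other entries $0$. Define $V_0^{(r)}(x,y)=1$ and $V_n^{(r)}(x,y)=\det A_n^{(r)}(x,y)$ for $n\ge 1$. Powers $(1-u)^{a}$ are understood as binomial series $\sum_k\binom{a}{k}(-u)^k$. -}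

module Defs where

open import Data.Nat as ℕ using (ℕ; zero; suc; _≤?_)
open import Data.Nat.Divisibility using (_∣?_)
open import Data.Integer as ℤ using (+_)
open import Data.Rational using (ℚ; _/_; 0ℚ; 1ℚ; _+_; _*_; _-_; -_)
open import Data.Fin using (Fin; zero; suc; toℕ; punchIn)
open import Data.Bool using (Bool; true; false; if_then_else_; _∧_)
open import Relation.Nullary.Decidable using (⌊_⌋)

ℕ→ℚ : ℕ → ℚ
ℕ→ℚ n = + n / 1

sgn : ℕ → ℚ
sgn zero    = 1ℚ
sgn (suc k) = - sgn k

sumFin : (n : ℕ) → (Fin n → ℚ) → ℚ
sumFin zero    f = 0ℚ
sumFin (suc n) f = f zero + sumFin n (λ i → f (suc i))

det : (n : ℕ) → (Fin n → Fin n → ℚ) → ℚ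
det zero    M = 1ℚ
det (suc n) M =
  sumFin (suc n) (λ j → sgn (toℕ j) * M zero j * det n (λ i k → M (suc i) (punchIn j k)))

-- entry a_{i,j} of A_n^{(r)}(x,y), with 1-based indices i j
entry : (r : ℕ) → ℚ → ℚ → ℕ → ℕ → ℚ
entry r x y i j =
  if ⌊ j ℕ.≟ suc i ⌋ then - ℕ→ℚ i
  else if ⌊ j ≤? i ⌋ ∧ ⌊ i ≤? j ℕ.+ (r ℕ.∸ 2) ⌋ then x
  else if ⌊ r ≤? i ⌋ ∧ ⌊ j ℕ.≟ i ℕ.+ 1 ℕ.∸ r ⌋ then (y + ℕ→ℚ i) - ℕ→ℚ r
  else 0ℚ

A : (r n : ℕ) → ℚ → ℚ → Fin n → Fin n → ℚ
A r n x y i j = entry r x y (suc (toℕ i)) (suc (toℕ j))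

V : (r n : ℕ) → ℚ → ℚ → ℚ
V r zero    x y = 1ℚ
V r (suc n) x y = det (suc n) (A r (suc n) x y)

-- formal power series in t over ℚ, as coefficient sequences
PS : Set
PS = ℕ → ℚ

_⋆_ : PS → PS → PS
(f ⋆ g) n = sumFin (suc n) (λ k → f (toℕ k) * g (n ℕ.∸ toℕ k))

binom : ℚ → ℕ → ℚ
binom a zero    = 1ℚ
binom a (suc k) = binom a k * (a - ℕ→ℚ k) * (+ 1 / suc k)

-- (1 - u)^a = Σ_k binom a k (-u)^k
oneMinusPow : ℚ → PS
oneMinusPow a k = binom a k * sgn k

-- substitution u = t^r  (r ≥ 1)
substPow : (r : ℕ) → .{{_ : ℕ.NonZero r}} → PS → PS
substPow r f n = if ⌊ r ∣? n ⌋ then f (n ℕ./ r) else 0ℚ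

invFact : ℕ → ℚ
invFact zero    = 1ℚ
invFact (suc n) = invFact n * (+ 1 / suc n)

egf : (ℕ → ℚ) → PS
egf a n = a n * invFact n

-- V_n is the n-th leading principal minor of the infinite lower Hessenberg matrix (a_{i,j}),
-- whose superdiagonal is -1, -2, -3, ....  Expanding along the last row gives
-- (n+1) v_{n+1} = Σ_{j ≤ n} a_{n+1,j+1} v_j for v_n = V_n / n!.  Row n+1 holds x in the r - 1
-- columns ending at the diagonal and y + n + 1 - r just before them, so in generating-function
-- form the recurrence reads (1 - t^r) H' = x (1 + t + ... + t^(r-1)) H + (y - x) t^(r-1) H.
-- The product H = S G of S = (1 - t^r)^((x-y)/r) and G = (1 - t)^(-x) satisfies the same
-- equation, because (1 - t) G' = x G and (1 - t^r) S' = (y - x) t^(r-1) S, and both sides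
-- have constant term 1, which determines a solution of the recurrence.

module Submission where

open import Defs
open import Level using (0ℓ)
open import Function.Base using (_∘_)
open import Algebra.Bundles using (CommutativeRing)
open import Data.Bool.Base using (true; false)
open import Data.Bool.Properties using (∧-zeroʳ)
open import Data.Empty using (⊥-elim)
open import Data.Fin.Base using (Fin; zero; suc; toℕ; punchIn)
open import Data.Fin.Properties using (toℕ≤pred[n]; toℕ<n)
open import Data.Integer.Base as ℤ using (+_; 1ℤ)
import Data.Integer.Tactic.RingSolver as ℤ-Solver
open import Data.Nat.Base as ℕ using (ℕ; zero; suc; _≤_; NonZero; z≤n; s≤s)
import Data.Nat.Properties as ℕₚ
import Data.Nat.Tactic.RingSolver as ℕ-Solver
open import Data.Nat.Divisibility using (_∣_; _∣?_; divides; n∣m*n; ∣⇒≤; ∣m+n∣m⇒∣n; ∣-refl)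
open import Data.Nat.DivMod using (m*n/n≡m)
open import Data.Nat.Induction using (<-rec)
open import Data.Product.Base using (_,_)
open import Data.Rational.Base using (ℚ; _/_; 0ℚ; 1ℚ; _+_; _*_; _-_; -_; toℚᵘ)
open import Data.Rational.Properties
  using (_≟_; +-*-commutativeRing; toℚᵘ-injective; toℚᵘ-homo-+; toℚᵘ-homo-*; toℚᵘ-fromℚᵘ;
         +-identityˡ; +-identityʳ; *-identityˡ; *-identityʳ; *-zeroˡ; *-zeroʳ;
         *-distribˡ-+; *-distribʳ-+; neg-distribˡ-*; +-assoc; *-assoc)
import Data.Rational.Unnormalised.Base as ℚᵘ
import Data.Rational.Unnormalised.Properties as ℚᵘ
open import Relation.Binary.Definitions using (tri<; tri≈; tri>)
open import Relation.Binary.PropositionalEquality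
open import Relation.Nullary.Decidable using (Dec; yes; no; ⌊_⌋; isYes≗does; dec-true; dec-false; dec⇒maybe)
open import Relation.Nullary.Negation using (¬_)
open import Tactic.RingSolver using (solve-∀)
open import Tactic.RingSolver.Core.AlmostCommutativeRing using (AlmostCommutativeRing; fromCommutativeRing)

open CommutativeRing +-*-commutativeRing using () renaming (semiring to ℚ-semiring)
open import Algebra.Properties.Semiring.Mult ℚ-semiring using (_×_; ×-homo-+; ×1-homo-*)
open import Algebra.Properties.Semiring.Sum ℚ-semiring
  using (sum; sum-cong-≗; sum-replicate-zero; ∑-distrib-+; *-distribˡ-sum; *-distribʳ-sum)

ℚ-ring : AlmostCommutativeRing 0ℓ 0ℓ
ℚ-ring = fromCommutativeRing +-*-commutativeRing (λ q → dec⇒maybe (0ℚ ≟ q))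

⌊⌋-true : ∀ {P : Set} (p? : Dec P) → P → ⌊ p? ⌋ ≡ true
⌊⌋-true p? p = trans (isYes≗does p?) (dec-true p? p)

⌊⌋-false : ∀ {P : Set} (p? : Dec P) → ¬ P → ⌊ p? ⌋ ≡ false
⌊⌋-false p? ¬p = trans (isYes≗does p?) (dec-false p? ¬p)

ℕ→ℚᵘ : ∀ n → toℚᵘ (ℕ→ℚ n) ℚᵘ.≃ ℚᵘ.mkℚᵘ (+ n) 0
ℕ→ℚᵘ n = toℚᵘ-fromℚᵘ (ℚᵘ.mkℚᵘ (+ n) 0)

ℕ→ℚ-suc : ∀ n → ℕ→ℚ (suc n) ≡ 1ℚ + ℕ→ℚ n
ℕ→ℚ-suc n = toℚᵘ-injective (begin
  toℚᵘ (ℕ→ℚ (suc n))              ≈⟨ ℕ→ℚᵘ (suc n) ⟩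
  ℚᵘ.mkℚᵘ (+ suc n) 0             ≈⟨ ℚᵘ.*≡* (ℤ-identity (+ n)) ⟩
  ℚᵘ.1ℚᵘ ℚᵘ.+ ℚᵘ.mkℚᵘ (+ n) 0     ≈⟨ ℚᵘ.+-congʳ ℚᵘ.1ℚᵘ (ℕ→ℚᵘ n) ⟨
  toℚᵘ 1ℚ ℚᵘ.+ toℚᵘ (ℕ→ℚ n)       ≈⟨ toℚᵘ-homo-+ 1ℚ (ℕ→ℚ n) ⟨
  toℚᵘ (1ℚ + ℕ→ℚ n)               ∎)
  where
  open ℚᵘ.≃-Reasoning
  ℤ-identity : ∀ a → (1ℤ ℤ.+ a) ℤ.* (1ℤ ℤ.* 1ℤ) ≡ (1ℤ ℤ.* 1ℤ ℤ.+ a ℤ.* 1ℤ) ℤ.* 1ℤ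
  ℤ-identity = ℤ-Solver.solve-∀

ℕ→ℚ-*-inverse : ∀ n → ℕ→ℚ (suc n) * (+ 1 / suc n) ≡ 1ℚ
ℕ→ℚ-*-inverse n = toℚᵘ-injective (begin
  toℚᵘ (ℕ→ℚ (suc n) * (+ 1 / suc n))
    ≈⟨ toℚᵘ-homo-* (ℕ→ℚ (suc n)) (+ 1 / suc n) ⟩
  toℚᵘ (ℕ→ℚ (suc n)) ℚᵘ.* toℚᵘ (+ 1 / suc n)
    ≈⟨ ℚᵘ.*-cong (ℕ→ℚᵘ (suc n)) (toℚᵘ-fromℚᵘ (ℚᵘ.mkℚᵘ (+ 1) n)) ⟩
  ℚᵘ.mkℚᵘ (+ suc n) 0 ℚᵘ.* ℚᵘ.mkℚᵘ (+ 1) n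
    ≈⟨ ℚᵘ.*-inverseʳ (ℚᵘ.mkℚᵘ (+ suc n) 0) ⟩
  ℚᵘ.1ℚᵘ
    ∎)
  where open ℚᵘ.≃-Reasoning

ℕ→ℚ-*-cancel : ∀ n p → ℕ→ℚ (suc n) * (p * (+ 1 / suc n)) ≡ p
ℕ→ℚ-*-cancel n p = begin
  ℕ→ℚ (suc n) * (p * (+ 1 / suc n))   ≡⟨ swap (ℕ→ℚ (suc n)) p (+ 1 / suc n) ⟩
  p * (ℕ→ℚ (suc n) * (+ 1 / suc n))   ≡⟨ cong (p *_) (ℕ→ℚ-*-inverse n) ⟩
  p * 1ℚ                              ≡⟨ *-identityʳ p ⟩
  p                                   ∎
  where
  open ≡-Reasoning
  swap : ∀ a b c → a * (b * c) ≡ b * (a * c)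
  swap = solve-∀ ℚ-ring

ℕ→ℚ-*-cancelˡ : ∀ n {p q} → ℕ→ℚ (suc n) * p ≡ ℕ→ℚ (suc n) * q → p ≡ q
ℕ→ℚ-*-cancelˡ n {p} {q} eq = begin
  p                                   ≡⟨ ℕ→ℚ-*-cancel n p ⟨
  ℕ→ℚ (suc n) * (p * (+ 1 / suc n))   ≡⟨ *-assoc (ℕ→ℚ (suc n)) p (+ 1 / suc n) ⟨
  ℕ→ℚ (suc n) * p * (+ 1 / suc n)     ≡⟨ cong (_* (+ 1 / suc n)) eq ⟩
  ℕ→ℚ (suc n) * q * (+ 1 / suc n)     ≡⟨ *-assoc (ℕ→ℚ (suc n)) q (+ 1 / suc n) ⟩
  ℕ→ℚ (suc n) * (q * (+ 1 / suc n))   ≡⟨ ℕ→ℚ-*-cancel n q ⟩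
  q                                   ∎
  where open ≡-Reasoning

ℕ→ℚ≡×1 : ∀ n → ℕ→ℚ n ≡ n × 1ℚ
ℕ→ℚ≡×1 zero    = refl
ℕ→ℚ≡×1 (suc n) = trans (ℕ→ℚ-suc n) (cong (_+_ 1ℚ) (ℕ→ℚ≡×1 n))

ℕ→ℚ-homo-+ : ∀ m n → ℕ→ℚ (m ℕ.+ n) ≡ ℕ→ℚ m + ℕ→ℚ n
ℕ→ℚ-homo-+ m n = begin
  ℕ→ℚ (m ℕ.+ n)     ≡⟨ ℕ→ℚ≡×1 (m ℕ.+ n) ⟩
  (m ℕ.+ n) × 1ℚ    ≡⟨ ×-homo-+ 1ℚ m n ⟩
  m × 1ℚ + n × 1ℚ   ≡⟨ cong₂ _+_ (ℕ→ℚ≡×1 m) (ℕ→ℚ≡×1 n) ⟨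
  ℕ→ℚ m + ℕ→ℚ n     ∎
  where open ≡-Reasoning

ℕ→ℚ-homo-* : ∀ m n → ℕ→ℚ (m ℕ.* n) ≡ ℕ→ℚ m * ℕ→ℚ n
ℕ→ℚ-homo-* m n = begin
  ℕ→ℚ (m ℕ.* n)     ≡⟨ ℕ→ℚ≡×1 (m ℕ.* n) ⟩
  (m ℕ.* n) × 1ℚ    ≡⟨ ×1-homo-* m n ⟩
  m × 1ℚ * n × 1ℚ   ≡⟨ cong₂ _*_ (ℕ→ℚ≡×1 m) (ℕ→ℚ≡×1 n) ⟨
  ℕ→ℚ m * ℕ→ℚ n     ∎
  where open ≡-Reasoning

sumFin≡sum : ∀ n (f : Fin n → ℚ) → sumFin n f ≡ sum f
sumFin≡sum zero    f = refl
sumFin≡sum (suc n) f = cong (_+_ (f zero)) (sumFin≡sum n (f ∘ suc))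

sumFin-cong : ∀ n {f g : Fin n → ℚ} → f ≗ g → sumFin n f ≡ sumFin n g
sumFin-cong n {f} {g} f≗g rewrite sumFin≡sum n f | sumFin≡sum n g = sum-cong-≗ f≗g

sumFin-zero : ∀ n {f : Fin n → ℚ} → (∀ i → f i ≡ 0ℚ) → sumFin n f ≡ 0ℚ
sumFin-zero n {f} f≗0 rewrite sumFin≡sum n f = trans (sum-cong-≗ f≗0) (sum-replicate-zero n)

sumFin-+ : ∀ n (f g : Fin n → ℚ) → sumFin n (λ i → f i + g i) ≡ sumFin n f + sumFin n g
sumFin-+ n f g rewrite sumFin≡sum n (λ i → f i + g i) | sumFin≡sum n f | sumFin≡sum n g = ∑-distrib-+ f g

sumFin-*ˡ : ∀ n c (f : Fin n → ℚ) → sumFin n (λ i → c * f i) ≡ c * sumFin n f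
sumFin-*ˡ n c f rewrite sumFin≡sum n (λ i → c * f i) | sumFin≡sum n f = sym (*-distribˡ-sum c f)

sumFin-*ʳ : ∀ n c (f : Fin n → ℚ) → sumFin n (λ i → f i * c) ≡ sumFin n f * c
sumFin-*ʳ n c f rewrite sumFin≡sum n (λ i → f i * c) | sumFin≡sum n f = sym (*-distribʳ-sum c f)

sumFin-linear : ∀ n a b (f g : Fin n → ℚ) →
                sumFin n (λ i → a * f i - b * g i) ≡ a * sumFin n f - b * sumFin n g
sumFin-linear n a b f g = begin
  sumFin n (λ i → a * f i - b * g i)
    ≡⟨ sumFin-cong n (λ i → cong (_+_ (a * f i)) (neg-distribˡ-* b (g i))) ⟩
  sumFin n (λ i → a * f i + (- b) * g i)
    ≡⟨ sumFin-+ n _ _ ⟩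
  sumFin n (λ i → a * f i) + sumFin n (λ i → (- b) * g i)
    ≡⟨ cong₂ _+_ (sumFin-*ˡ n a f) (sumFin-*ˡ n (- b) g) ⟩
  a * sumFin n f + (- b) * sumFin n g
    ≡⟨ cong (_+_ (a * sumFin n f)) (neg-distribˡ-* b _) ⟨
  a * sumFin n f - b * sumFin n g
    ∎
  where open ≡-Reasoning

-- Lower Hessenberg determinants

Matrix : Set
Matrix = ℕ → ℕ → ℚ

leadingMinor : Matrix → ℕ → ℚ
leadingMinor M n = det n (λ i j → M (toℕ i) (toℕ j))

IsLowerHessenberg : Matrix → Set
IsLowerHessenberg M = ∀ i j → suc i ℕ.< j → M i j ≡ 0ℚ

submatrix₀₀ : Matrix → Matrix
submatrix₀₀ M i j = M (suc i) (suc j)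

submatrix₀₁ : Matrix → Matrix
submatrix₀₁ M i zero    = M (suc i) 0
submatrix₀₁ M i (suc j) = M (suc i) (suc (suc j))

submatrix₀₀-lowerHessenberg : ∀ M → IsLowerHessenberg M → IsLowerHessenberg (submatrix₀₀ M)
submatrix₀₀-lowerHessenberg M hess i j i+1<j = hess (suc i) (suc j) (s≤s i+1<j)

submatrix₀₁-lowerHessenberg : ∀ M → IsLowerHessenberg M → IsLowerHessenberg (submatrix₀₁ M)
submatrix₀₁-lowerHessenberg M hess i (suc j) i+1<j+1 = hess (suc i) (suc (suc j)) (s≤s i+1<j+1)

det-cong : ∀ n {M N : Fin n → Fin n → ℚ} → (∀ i j → M i j ≡ N i j) → det n M ≡ det n N
det-cong zero    M≡N = refl
det-cong (suc n) M≡N = sumFin-cong (suc n) λ j →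
  cong₂ (λ m d → sgn (toℕ j) * m * d) (M≡N zero j) (det-cong n (λ i k → M≡N (suc i) (punchIn j k)))

-- The first row of a lower Hessenberg matrix has at most two nonzero entries.
leadingMinor-expand : ∀ m M → IsLowerHessenberg M →
  leadingMinor M (suc (suc m))
    ≡ M 0 0 * leadingMinor (submatrix₀₀ M) (suc m) - M 0 1 * leadingMinor (submatrix₀₁ M) (suc m)
leadingMinor-expand m M hess = begin
  leadingMinor M (suc (suc m))
    ≡⟨⟩
  1ℚ * M 0 0 * L₀₀ + (- 1ℚ * M 0 1 * det (suc m) (λ i k → M (suc (toℕ i)) (toℕ (punchIn (suc zero) k))) + rest)
    ≡⟨ cong₂ (λ d e → 1ℚ * M 0 0 * L₀₀ + (- 1ℚ * M 0 1 * d + e)) (det-cong (suc m) column) rest≡0 ⟩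
  1ℚ * M 0 0 * L₀₀ + (- 1ℚ * M 0 1 * L₀₁ + 0ℚ)
    ≡⟨ simplify (M 0 0) L₀₀ (M 0 1) L₀₁ ⟩
  M 0 0 * L₀₀ - M 0 1 * L₀₁
    ∎
  where
  open ≡-Reasoning
  L₀₀ L₀₁ rest : ℚ
  L₀₀ = leadingMinor (submatrix₀₀ M) (suc m)
  L₀₁ = leadingMinor (submatrix₀₁ M) (suc m)
  2+ : Fin m → ℕ
  2+ j = suc (suc (toℕ j))
  minorAt : Fin m → ℚ
  minorAt j = det (suc m) (λ i k → M (suc (toℕ i)) (toℕ (punchIn (suc (suc j)) k)))
  rest = sumFin m (λ j → sgn (2+ j) * M 0 (2+ j) * minorAt j)
  column : ∀ i k → M (suc (toℕ i)) (toℕ (punchIn (suc zero) k)) ≡ submatrix₀₁ M (toℕ i) (toℕ k)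
  column i zero    = refl
  column i (suc k) = refl
  vanish : ∀ a b → a * 0ℚ * b ≡ 0ℚ
  vanish = solve-∀ ℚ-ring
  rest≡0 : rest ≡ 0ℚ
  rest≡0 = sumFin-zero m λ j →
    trans (cong (λ e → sgn (2+ j) * e * minorAt j) (hess 0 (2+ j) (s≤s (s≤s z≤n)))) (vanish (sgn (2+ j)) (minorAt j))
  simplify : ∀ a b c d → 1ℚ * a * b + (- 1ℚ * c * d + 0ℚ) ≡ a * b - c * d
  simplify = solve-∀ ℚ-ring

prodUpTo : (ℕ → ℚ) → ℕ → ℚ
prodUpTo f zero    = 1ℚ
prodUpTo f (suc m) = f 0 * prodUpTo (f ∘ suc) m

superdiagonalProduct : Matrix → ℕ → ℕ → ℚ
superdiagonalProduct M j n = prodUpTo (λ k → - M (j ℕ.+ k) (suc (j ℕ.+ k))) (n ℕ.∸ j)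

leadingMinor-recurrence : ∀ n M → IsLowerHessenberg M →
  leadingMinor M (suc n)
    ≡ sumFin (suc n) (λ j → M n (toℕ j) * superdiagonalProduct M (toℕ j) n * leadingMinor M (toℕ j))
leadingMinor-recurrence zero    M hess = simplify (M 0 0)
  where
  simplify : ∀ a → 1ℚ * a * 1ℚ + 0ℚ ≡ a * 1ℚ * 1ℚ + 0ℚ
  simplify = solve-∀ ℚ-ring
leadingMinor-recurrence (suc n) M hess = begin
  leadingMinor M (suc (suc n))
    ≡⟨ leadingMinor-expand n M hess ⟩
  M 0 0 * leadingMinor M₀₀ (suc n) - M 0 1 * leadingMinor M₀₁ (suc n)
    ≡⟨ cong₂ (λ u v → M 0 0 * u - M 0 1 * v)
             (leadingMinor-recurrence n M₀₀ (submatrix₀₀-lowerHessenberg M hess))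
             (leadingMinor-recurrence n M₀₁ (submatrix₀₁-lowerHessenberg M hess)) ⟩
  M 0 0 * (M₁ 1 * P * 1ℚ + sumFin n σ₀₀) - M 0 1 * (M₁ 0 * P * 1ℚ + sumFin n σ₀₁)
    ≡⟨ split (M 0 0) (M 0 1) (M₁ 0) (M₁ 1) P (sumFin n σ₀₀) (sumFin n σ₀₁) ⟩
  firstTwo + (M 0 0 * sumFin n σ₀₀ - M 0 1 * sumFin n σ₀₁)
    ≡⟨ cong (_+_ firstTwo) (sumFin-linear n (M 0 0) (M 0 1) σ₀₀ σ₀₁) ⟨
  firstTwo + sumFin n (λ j → M 0 0 * σ₀₀ j - M 0 1 * σ₀₁ j)
    ≡⟨ cong (_+_ firstTwo) (sumFin-cong n λ j →
         trans (factor (M 0 0) (M 0 1) (M₁ (2+ j)) (superdiagonalProduct M (2+ j) (suc n)) _ _)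
               (sym (cong (term j) (leadingMinor-expand (toℕ j) M hess)))) ⟩
  firstTwo + sumFin n (λ j → term j (leadingMinor M (2+ j)))
    ≡⟨ +-assoc (M₁ 0 * (- M 0 1 * P) * 1ℚ) (M₁ 1 * P * (1ℚ * M 0 0 * 1ℚ + 0ℚ)) _ ⟩
  sumFin (suc (suc n)) (λ j → M₁ (toℕ j) * superdiagonalProduct M (toℕ j) (suc n) * leadingMinor M (toℕ j))
    ∎
  where
  open ≡-Reasoning
  M₀₀ M₀₁ : Matrix
  M₀₀ = submatrix₀₀ M
  M₀₁ = submatrix₀₁ M
  M₁ : ℕ → ℚ
  M₁ = M (suc n)
  P : ℚ
  P = superdiagonalProduct M 1 (suc n)
  firstTwo : ℚ
  firstTwo = M₁ 0 * (- M 0 1 * P) * 1ℚ + M₁ 1 * P * (1ℚ * M 0 0 * 1ℚ + 0ℚ)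
  2+ : Fin n → ℕ
  2+ j = suc (suc (toℕ j))
  term : Fin n → ℚ → ℚ
  term j d = M₁ (2+ j) * superdiagonalProduct M (2+ j) (suc n) * d
  σ₀₀ σ₀₁ : Fin n → ℚ
  σ₀₀ j = term j (leadingMinor M₀₀ (suc (toℕ j)))
  σ₀₁ j = term j (leadingMinor M₀₁ (suc (toℕ j)))
  split : ∀ m₀₀ m₀₁ e₀ e₁ p σ τ →
    m₀₀ * (e₁ * p * 1ℚ + σ) - m₀₁ * (e₀ * p * 1ℚ + τ)
      ≡ (e₀ * (- m₀₁ * p) * 1ℚ + e₁ * p * (1ℚ * m₀₀ * 1ℚ + 0ℚ)) + (m₀₀ * σ - m₀₁ * τ)
  split = solve-∀ ℚ-ring
  factor : ∀ a b e c u v → a * (e * c * u) - b * (e * c * v) ≡ e * c * (a * u - b * v)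
  factor = solve-∀ ℚ-ring

-- Formal power series

infixl 6 _⊕_
infixr 7 _•_

_⊕_ : PS → PS → PS
(f ⊕ g) n = f n + g n

_•_ : ℚ → PS → PS
(c • f) n = c * f n

0ₚ : PS
0ₚ _ = 0ℚ

1ₚ : PS
1ₚ zero    = 1ℚ
1ₚ (suc _) = 0ℚ

tail : PS → PS
tail f = f ∘ suc

shift₁ : PS → PS
shift₁ f zero    = 0ℚ
shift₁ f (suc n) = f n

shift : ℕ → PS → PS
shift zero    f = f
shift (suc m) f = shift₁ (shift m f)

monomial : ℕ → PS
monomial m = shift m 1ₚ

geometric : ℕ → PS
geometric zero    = 0ₚ
geometric (suc m) = 1ₚ ⊕ shift₁ (geometric m)

euler : PS → PS
euler f n = ℕ→ℚ n * f n

deriv : PS → PS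
deriv f n = ℕ→ℚ (suc n) * f (suc n)

shift₁-cong : ∀ {f g} → f ≗ g → shift₁ f ≗ shift₁ g
shift₁-cong f≗g zero    = refl
shift₁-cong f≗g (suc n) = f≗g n

shift-cong : ∀ m {f g} → f ≗ g → shift m f ≗ shift m g
shift-cong zero    f≗g = f≗g
shift-cong (suc m) f≗g = shift₁-cong (shift-cong m f≗g)

shift-⊕ : ∀ m f g → shift m (f ⊕ g) ≗ shift m f ⊕ shift m g
shift-⊕ zero    f g n       = refl
shift-⊕ (suc m) f g zero    = sym (+-identityʳ 0ℚ)
shift-⊕ (suc m) f g (suc n) = shift-⊕ m f g n

shift-• : ∀ m c f → shift m (c • f) ≗ c • shift m f
shift-• zero    c f n       = refl
shift-• (suc m) c f zero    = sym (*-zeroʳ c)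
shift-• (suc m) c f (suc n) = shift-• m c f n

shift-shift₁ : ∀ m f → shift m (shift₁ f) ≗ shift (suc m) f
shift-shift₁ zero    f = λ _ → refl
shift-shift₁ (suc m) f = shift₁-cong (shift-shift₁ m f)

shift-+ : ∀ m f k → shift m f (m ℕ.+ k) ≡ f k
shift-+ zero    f k = refl
shift-+ (suc m) f k = shift-+ m f k

shift-< : ∀ m f k → k ℕ.< m → shift m f k ≡ 0ℚ
shift-< (suc m) f zero    _           = refl
shift-< (suc m) f (suc k) (s≤s k<m) = shift-< m f k k<m

shift₁-deriv : ∀ f → shift₁ (deriv f) ≗ euler f
shift₁-deriv f zero    = sym (*-zeroˡ (f 0))
shift₁-deriv f (suc n) = refl

monomial-diagonal : ∀ m → monomial m m ≡ 1ℚ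
monomial-diagonal zero    = refl
monomial-diagonal (suc m) = monomial-diagonal m

monomial-offDiagonal : ∀ m k → k ≢ m → monomial m k ≡ 0ℚ
monomial-offDiagonal zero    zero    k≢m = ⊥-elim (k≢m refl)
monomial-offDiagonal zero    (suc k) k≢m = refl
monomial-offDiagonal (suc m) zero    k≢m = refl
monomial-offDiagonal (suc m) (suc k) k≢m = monomial-offDiagonal m k (k≢m ∘ cong suc)

geometric-< : ∀ m k → k ℕ.< m → geometric m k ≡ 1ℚ
geometric-< (suc m) zero    _         = +-identityʳ 1ℚ
geometric-< (suc m) (suc k) (s≤s k<m) = trans (+-identityˡ _) (geometric-< m k k<m)

geometric-≥ : ∀ m k → m ≤ k → geometric m k ≡ 0ℚ
geometric-≥ zero    k       _         = refl
geometric-≥ (suc m) (suc k) (s≤s m≤k) = trans (+-identityˡ _) (geometric-≥ m k m≤k)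

⋆-summand : PS → PS → (n : ℕ) → Fin (suc n) → ℚ
⋆-summand f g n k = f (toℕ k) * g (n ℕ.∸ toℕ k)

⋆-cong : ∀ {f f′ g g′} → f ≗ f′ → g ≗ g′ → f ⋆ g ≗ f′ ⋆ g′
⋆-cong f≗f′ g≗g′ n = sumFin-cong (suc n) λ k → cong₂ _*_ (f≗f′ (toℕ k)) (g≗g′ (n ℕ.∸ toℕ k))

⋆-distribˡ-⊕ : ∀ f g h → f ⋆ (g ⊕ h) ≗ f ⋆ g ⊕ f ⋆ h
⋆-distribˡ-⊕ f g h n =
  trans (sumFin-cong (suc n) λ k → *-distribˡ-+ (f (toℕ k)) (g (n ℕ.∸ toℕ k)) (h (n ℕ.∸ toℕ k)))
        (sumFin-+ (suc n) (⋆-summand f g n) (⋆-summand f h n))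

⋆-distribʳ-⊕ : ∀ f g h → (f ⊕ g) ⋆ h ≗ f ⋆ h ⊕ g ⋆ h
⋆-distribʳ-⊕ f g h n =
  trans (sumFin-cong (suc n) λ k → *-distribʳ-+ (h (n ℕ.∸ toℕ k)) (f (toℕ k)) (g (toℕ k)))
        (sumFin-+ (suc n) (⋆-summand f h n) (⋆-summand g h n))

⋆-•ˡ : ∀ c f g → (c • f) ⋆ g ≗ c • (f ⋆ g)
⋆-•ˡ c f g n = trans (sumFin-cong (suc n) λ k → *-assoc c (f (toℕ k)) (g (n ℕ.∸ toℕ k)))
                     (sumFin-*ˡ (suc n) c (⋆-summand f g n))

⋆-•ʳ : ∀ c f g → f ⋆ (c • g) ≗ c • (f ⋆ g)
⋆-•ʳ c f g n = trans (sumFin-cong (suc n) λ k → swap (f (toℕ k)) c (g (n ℕ.∸ toℕ k)))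
                      (sumFin-*ˡ (suc n) c (⋆-summand f g n))
  where
  swap : ∀ a b d → a * (b * d) ≡ b * (a * d)
  swap = solve-∀ ℚ-ring

⋆-zeroʳ : ∀ f → f ⋆ 0ₚ ≗ 0ₚ
⋆-zeroʳ f n = sumFin-zero (suc n) λ k → *-zeroʳ (f (toℕ k))

⋆-identityʳ : ∀ f → f ⋆ 1ₚ ≗ f
⋆-identityʳ f zero    = trans (+-identityʳ _) (*-identityʳ (f 0))
⋆-identityʳ f (suc n) = trans (cong₂ _+_ (*-zeroʳ (f 0)) (⋆-identityʳ (tail f) n)) (+-identityˡ _)

⋆-shift₁ˡ : ∀ f g → shift₁ f ⋆ g ≗ shift₁ (f ⋆ g)
⋆-shift₁ˡ f g zero    = trans (+-identityʳ _) (*-zeroˡ (g 0))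
⋆-shift₁ˡ f g (suc n) = trans (cong (_+ (f ⋆ g) n) (*-zeroˡ (g (suc n)))) (+-identityˡ _)

⋆-shift₁ʳ : ∀ f g → f ⋆ shift₁ g ≗ shift₁ (f ⋆ g)
⋆-shift₁ʳ f g zero    = trans (+-identityʳ _) (*-zeroʳ (f 0))
⋆-shift₁ʳ f g (suc n) = trans (cong (_+_ (f 0 * g n)) (⋆-shift₁ʳ (tail f) g n)) (unfold n)
  where
  unfold : ∀ n → f 0 * g n + shift₁ (tail f ⋆ g) n ≡ (f ⋆ g) n
  unfold zero    = refl
  unfold (suc n) = refl

⋆-shiftˡ : ∀ m f g → shift m f ⋆ g ≗ shift m (f ⋆ g)
⋆-shiftˡ zero    f g n = refl
⋆-shiftˡ (suc m) f g n = trans (⋆-shift₁ˡ (shift m f) g n) (shift₁-cong (⋆-shiftˡ m f g) n)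

⋆-shiftʳ : ∀ m f g → f ⋆ shift m g ≗ shift m (f ⋆ g)
⋆-shiftʳ zero    f g n = refl
⋆-shiftʳ (suc m) f g n = trans (⋆-shift₁ʳ f (shift m g) n) (shift₁-cong (⋆-shiftʳ m f g) n)

⋆-monomialʳ : ∀ m f → f ⋆ monomial m ≗ shift m f
⋆-monomialʳ m f n = trans (⋆-shiftʳ m f 1ₚ n) (shift-cong m (⋆-identityʳ f) n)

⋆-assoc : ∀ f g h → (f ⋆ g) ⋆ h ≗ f ⋆ (g ⋆ h)
⋆-assoc f g h zero    = regroup (f 0) (g 0) (h 0)
  where
  regroup : ∀ a b c → (a * b + 0ℚ) * c + 0ℚ ≡ a * (b * c + 0ℚ) + 0ℚ
  regroup = solve-∀ ℚ-ring
⋆-assoc f g h (suc n) = begin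
  (f 0 * g 0 + 0ℚ) * h (suc n) + (tail (f ⋆ g) ⋆ h) n
    ≡⟨ cong (_+_ ((f 0 * g 0 + 0ℚ) * h (suc n))) (begin
         (tail (f ⋆ g) ⋆ h) n
           ≡⟨ ⋆-distribʳ-⊕ (f 0 • tail g) (tail f ⋆ g) h n ⟩
         ((f 0 • tail g) ⋆ h) n + ((tail f ⋆ g) ⋆ h) n
           ≡⟨ cong₂ _+_ (⋆-•ˡ (f 0) (tail g) h n) (⋆-assoc (tail f) g h n) ⟩
         f 0 * (tail g ⋆ h) n + (tail f ⋆ (g ⋆ h)) n
           ∎) ⟩
  (f 0 * g 0 + 0ℚ) * h (suc n) + (f 0 * (tail g ⋆ h) n + (tail f ⋆ (g ⋆ h)) n)
    ≡⟨ regroup (f 0) (g 0) (h (suc n)) _ _ ⟩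
  f 0 * (g 0 * h (suc n) + (tail g ⋆ h) n) + (tail f ⋆ (g ⋆ h)) n
    ∎
  where
  open ≡-Reasoning
  regroup : ∀ a b c d e → (a * b + 0ℚ) * c + (a * d + e) ≡ a * (b * c + d) + e
  regroup = solve-∀ ℚ-ring

-- n = k + (n - k) makes t d/dt a derivation.
euler-⋆ : ∀ f g → euler (f ⋆ g) ≗ euler f ⋆ g ⊕ f ⋆ euler g
euler-⋆ f g n = begin
  ℕ→ℚ n * (f ⋆ g) n
    ≡⟨ sumFin-*ˡ (suc n) (ℕ→ℚ n) (⋆-summand f g n) ⟨
  sumFin (suc n) (λ k → ℕ→ℚ n * (f (toℕ k) * g (n ℕ.∸ toℕ k)))
    ≡⟨ sumFin-cong (suc n) split ⟩
  sumFin (suc n) (λ k → euler f (toℕ k) * g (n ℕ.∸ toℕ k) + f (toℕ k) * euler g (n ℕ.∸ toℕ k))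
    ≡⟨ sumFin-+ (suc n) (⋆-summand (euler f) g n) (⋆-summand f (euler g) n) ⟩
  (euler f ⋆ g) n + (f ⋆ euler g) n
    ∎
  where
  open ≡-Reasoning
  distribute : ∀ a b u v → (a + b) * (u * v) ≡ a * u * v + u * (b * v)
  distribute = solve-∀ ℚ-ring
  split : ∀ (k : Fin (suc n)) → ℕ→ℚ n * (f (toℕ k) * g (n ℕ.∸ toℕ k))
                               ≡ euler f (toℕ k) * g (n ℕ.∸ toℕ k) + f (toℕ k) * euler g (n ℕ.∸ toℕ k)
  split k = begin
    ℕ→ℚ n * (f (toℕ k) * g (n ℕ.∸ toℕ k))
      ≡⟨ cong (λ m → ℕ→ℚ m * (f (toℕ k) * g (n ℕ.∸ toℕ k))) (ℕₚ.m+[n∸m]≡n (toℕ≤pred[n] k)) ⟨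
    ℕ→ℚ (toℕ k ℕ.+ (n ℕ.∸ toℕ k)) * (f (toℕ k) * g (n ℕ.∸ toℕ k))
      ≡⟨ cong (_* (f (toℕ k) * g (n ℕ.∸ toℕ k))) (ℕ→ℚ-homo-+ (toℕ k) (n ℕ.∸ toℕ k)) ⟩
    (ℕ→ℚ (toℕ k) + ℕ→ℚ (n ℕ.∸ toℕ k)) * (f (toℕ k) * g (n ℕ.∸ toℕ k))
      ≡⟨ distribute (ℕ→ℚ (toℕ k)) (ℕ→ℚ (n ℕ.∸ toℕ k)) (f (toℕ k)) (g (n ℕ.∸ toℕ k)) ⟩
    euler f (toℕ k) * g (n ℕ.∸ toℕ k) + f (toℕ k) * euler g (n ℕ.∸ toℕ k)
      ∎

deriv-⋆ : ∀ f g → deriv (f ⋆ g) ≗ deriv f ⋆ g ⊕ f ⋆ deriv g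
deriv-⋆ f g n = trans (euler-⋆ f g (suc n)) (cong₂ _+_ left right)
  where
  left : (euler f ⋆ g) (suc n) ≡ (deriv f ⋆ g) n
  left = trans (cong (_+ (deriv f ⋆ g) n) (trans (cong (_* g (suc n)) (*-zeroˡ (f 0))) (*-zeroˡ (g (suc n)))))
               (+-identityˡ _)
  right : (f ⋆ euler g) (suc n) ≡ (f ⋆ deriv g) n
  right = trans (⋆-cong {f = f} (λ _ → refl) (sym ∘ shift₁-deriv g) (suc n)) (⋆-shift₁ʳ f (deriv g) (suc n))

substPow-multiple : ∀ r .{{_ : NonZero r}} f q → substPow r f (q ℕ.* r) ≡ f q
substPow-multiple r f q rewrite ⌊⌋-true (r ∣? q ℕ.* r) (n∣m*n q) = cong f (m*n/n≡m q r)

substPow-nonmultiple : ∀ r .{{_ : NonZero r}} f k → ¬ r ∣ k → substPow r f k ≡ 0ℚ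
substPow-nonmultiple r f k r∤k rewrite ⌊⌋-false (r ∣? k) r∤k = refl

-- Recurrences

SatisfiesRecurrence : Matrix → PS → Set
SatisfiesRecurrence w f = ∀ n → deriv f n ≡ sumFin (suc n) (λ j → w n (toℕ j) * f (toℕ j))

recurrence-unique : ∀ w f g → SatisfiesRecurrence w f → SatisfiesRecurrence w g → f 0 ≡ g 0 → f ≗ g
recurrence-unique w f g f-rec g-rec f₀≡g₀ = <-rec (λ n → f n ≡ g n) step
  where
  step : ∀ n → (∀ {m} → m ℕ.< n → f m ≡ g m) → f n ≡ g n
  step zero    _  = f₀≡g₀
  step (suc n) ih = ℕ→ℚ-*-cancelˡ n (begin
    deriv f n
      ≡⟨ f-rec n ⟩
    sumFin (suc n) (λ j → w n (toℕ j) * f (toℕ j))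
      ≡⟨ sumFin-cong (suc n) (λ j → cong (w n (toℕ j) *_) (ih (toℕ<n j))) ⟩
    sumFin (suc n) (λ j → w n (toℕ j) * g (toℕ j))
      ≡⟨ g-rec n ⟨
    deriv g n
      ∎)
    where open ≡-Reasoning

prodUpTo-invFact : ∀ m j (d : ℕ → ℚ) → (∀ k → d k ≡ ℕ→ℚ (suc (j ℕ.+ k))) →
                   prodUpTo d m * invFact (j ℕ.+ m) ≡ invFact j
prodUpTo-invFact zero    j d _  = trans (*-identityˡ _) (cong invFact (ℕₚ.+-identityʳ j))
prodUpTo-invFact (suc m) j d d≡ = begin
  d 0 * prodUpTo (d ∘ suc) m * invFact (j ℕ.+ suc m)
    ≡⟨ cong₂ (λ u i → u * prodUpTo (d ∘ suc) m * invFact i)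
             (trans (d≡ 0) (cong (ℕ→ℚ ∘ suc) (ℕₚ.+-identityʳ j))) (ℕₚ.+-suc j m) ⟩
  ℕ→ℚ (suc j) * prodUpTo (d ∘ suc) m * invFact (suc j ℕ.+ m)
    ≡⟨ *-assoc (ℕ→ℚ (suc j)) _ _ ⟩
  ℕ→ℚ (suc j) * (prodUpTo (d ∘ suc) m * invFact (suc j ℕ.+ m))
    ≡⟨ cong (ℕ→ℚ (suc j) *_) (prodUpTo-invFact m (suc j) (d ∘ suc) d∘suc≡) ⟩
  ℕ→ℚ (suc j) * (invFact j * (+ 1 / suc j))
    ≡⟨ ℕ→ℚ-*-cancel j (invFact j) ⟩
  invFact j
    ∎
  where
  open ≡-Reasoning
  d∘suc≡ : ∀ k → d (suc k) ≡ ℕ→ℚ (suc (suc j ℕ.+ k))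
  d∘suc≡ k = trans (d≡ (suc k)) (cong (ℕ→ℚ ∘ suc) (ℕₚ.+-suc j k))

superdiagonalProduct-invFact : ∀ M → (∀ k → M k (suc k) ≡ - ℕ→ℚ (suc k)) → ∀ {j n} → j ≤ n →
                               superdiagonalProduct M j n * invFact n ≡ invFact j
superdiagonalProduct-invFact M superdiag {j} {n} j≤n = begin
  superdiagonalProduct M j n * invFact n
    ≡⟨ cong (λ i → superdiagonalProduct M j n * invFact i) (ℕₚ.m+[n∸m]≡n j≤n) ⟨
  superdiagonalProduct M j n * invFact (j ℕ.+ (n ℕ.∸ j))
    ≡⟨ prodUpTo-invFact (n ℕ.∸ j) j _ (λ k → trans (cong -_ (superdiag (j ℕ.+ k))) (neg-involutive _)) ⟩
  invFact j
    ∎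
  where
  open ≡-Reasoning
  neg-involutive : ∀ a → - (- a) ≡ a
  neg-involutive = solve-∀ ℚ-ring

leadingMinor-egf-recurrence : ∀ M → IsLowerHessenberg M → (∀ k → M k (suc k) ≡ - ℕ→ℚ (suc k)) →
                              SatisfiesRecurrence M (λ n → leadingMinor M n * invFact n)
leadingMinor-egf-recurrence M hess superdiag n = begin
  ℕ→ℚ (suc n) * (leadingMinor M (suc n) * (invFact n * (+ 1 / suc n)))
    ≡⟨ cong (ℕ→ℚ (suc n) *_) (*-assoc (leadingMinor M (suc n)) (invFact n) (+ 1 / suc n)) ⟨
  ℕ→ℚ (suc n) * (leadingMinor M (suc n) * invFact n * (+ 1 / suc n))
    ≡⟨ ℕ→ℚ-*-cancel n _ ⟩
  leadingMinor M (suc n) * invFact n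
    ≡⟨ cong (_* invFact n) (leadingMinor-recurrence n M hess) ⟩
  sumFin (suc n) term * invFact n
    ≡⟨ sumFin-*ʳ (suc n) (invFact n) term ⟨
  sumFin (suc n) (λ j → term j * invFact n)
    ≡⟨ sumFin-cong (suc n) (λ j →
         trans (regroup (M n (toℕ j)) (superdiagonalProduct M (toℕ j) n) (leadingMinor M (toℕ j)) (invFact n))
               (cong (λ u → M n (toℕ j) * (leadingMinor M (toℕ j) * u))
                     (superdiagonalProduct-invFact M superdiag (toℕ≤pred[n] j)))) ⟩
  sumFin (suc n) (λ j → M n (toℕ j) * (leadingMinor M (toℕ j) * invFact (toℕ j)))
    ∎
  where
  open ≡-Reasoning
  term : Fin (suc n) → ℚ
  term j = M n (toℕ j) * superdiagonalProduct M (toℕ j) n * leadingMinor M (toℕ j)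
  regroup : ∀ m c l i → m * c * l * i ≡ m * (l * (c * i))
  regroup = solve-∀ ℚ-ring

-- Differential equations

oneMinusPow-ode : ∀ a → deriv (oneMinusPow a) ≗ euler (oneMinusPow a) ⊕ (- a) • oneMinusPow a
oneMinusPow-ode a n = begin
  ℕ→ℚ (suc n) * (binom a n * (a - ℕ→ℚ n) * (+ 1 / suc n) * (- sgn n))
    ≡⟨ cong (ℕ→ℚ (suc n) *_) (swap (binom a n * (a - ℕ→ℚ n)) (+ 1 / suc n) (- sgn n)) ⟩
  ℕ→ℚ (suc n) * (binom a n * (a - ℕ→ℚ n) * (- sgn n) * (+ 1 / suc n))
    ≡⟨ ℕ→ℚ-*-cancel n _ ⟩
  binom a n * (a - ℕ→ℚ n) * (- sgn n)
    ≡⟨ expand (binom a n) a (ℕ→ℚ n) (sgn n) ⟩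
  ℕ→ℚ n * (binom a n * sgn n) + (- a) * (binom a n * sgn n)
    ∎
  where
  open ≡-Reasoning
  swap : ∀ u v w → u * v * w ≡ u * w * v
  swap = solve-∀ ℚ-ring
  expand : ∀ b a k σ → b * (a - k) * (- σ) ≡ k * (b * σ) + (- a) * (b * σ)
  expand = solve-∀ ℚ-ring

-- (1 - t^m) = (1 - t) (1 + t + ... + t^(m-1))
ode-telescope : ∀ {g c} → deriv g ≗ euler g ⊕ c • g →
                ∀ m → deriv g ≗ shift m (deriv g) ⊕ c • (g ⋆ geometric m)
ode-telescope {g} {c} ode zero n = sym (begin
  deriv g n + c * (g ⋆ 0ₚ) n   ≡⟨ cong (λ u → deriv g n + c * u) (⋆-zeroʳ g n) ⟩
  deriv g n + c * 0ℚ           ≡⟨ cong (_+_ (deriv g n)) (*-zeroʳ c) ⟩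
  deriv g n + 0ℚ               ≡⟨ +-identityʳ (deriv g n) ⟩
  deriv g n                    ∎)
  where open ≡-Reasoning
ode-telescope {g} {c} ode (suc m) n = begin
  deriv g n
    ≡⟨ ode n ⟩
  euler g n + c * g n
    ≡⟨ cong (_+ c * g n) (shift₁-deriv g n) ⟨
  shift₁ (deriv g) n + c * g n
    ≡⟨ cong (_+ c * g n) (shift₁-cong (ode-telescope {g} {c} ode m) n) ⟩
  shift₁ (shift m (deriv g) ⊕ c • (g ⋆ geometric m)) n + c * g n
    ≡⟨ cong (_+ c * g n) (shift-⊕ 1 (shift m (deriv g)) (c • (g ⋆ geometric m)) n) ⟩
  shift (suc m) (deriv g) n + shift₁ (c • (g ⋆ geometric m)) n + c * g n
    ≡⟨ cong (λ u → shift (suc m) (deriv g) n + u + c * g n) (shift-• 1 c (g ⋆ geometric m) n) ⟩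
  shift (suc m) (deriv g) n + c * shift₁ (g ⋆ geometric m) n + c * g n
    ≡⟨ regroup (shift (suc m) (deriv g) n) c (shift₁ (g ⋆ geometric m) n) (g n) ⟩
  shift (suc m) (deriv g) n + c * (g n + shift₁ (g ⋆ geometric m) n)
    ≡⟨ cong (λ u → shift (suc m) (deriv g) n + c * u) (begin
         g n + shift₁ (g ⋆ geometric m) n
           ≡⟨ cong₂ _+_ (⋆-identityʳ g n) (⋆-shift₁ʳ g (geometric m) n) ⟨
         (g ⋆ 1ₚ) n + (g ⋆ shift₁ (geometric m)) n
           ≡⟨ ⋆-distribˡ-⊕ g 1ₚ (shift₁ (geometric m)) n ⟨
         (g ⋆ geometric (suc m)) n
           ∎) ⟩
  shift (suc m) (deriv g) n + c * (g ⋆ geometric (suc m)) n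
    ∎
  where
  open ≡-Reasoning
  regroup : ∀ d c u v → d + c * u + c * v ≡ d + c * (v + u)
  regroup = solve-∀ ℚ-ring

substPow-coefficient : ∀ r .{{_ : NonZero r}} {f c} → deriv f ≗ euler f ⊕ c • f → ∀ k →
  ℕ→ℚ (r ℕ.+ k) * substPow r f (r ℕ.+ k) ≡ ℕ→ℚ k * substPow r f k + (ℕ→ℚ r * c) * substPow r f k
substPow-coefficient r {f} {c} ode k = by-divisibility k (r ∣? k)
  where
  open ≡-Reasoning
  S : PS
  S = substPow r f
  vanish : ∀ a b d → a * 0ℚ ≡ b * 0ℚ + d * 0ℚ
  vanish = solve-∀ ℚ-ring
  pull : ∀ ρ a b → a * ρ * b ≡ ρ * (a * b)
  pull = solve-∀ ℚ-ring
  push : ∀ ρ a b d → ρ * (a * b + d * b) ≡ a * ρ * b + (ρ * d) * b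
  push = solve-∀ ℚ-ring
  by-divisibility : ∀ k → Dec (r ∣ k) →
                    ℕ→ℚ (r ℕ.+ k) * S (r ℕ.+ k) ≡ ℕ→ℚ k * S k + (ℕ→ℚ r * c) * S k
  by-divisibility k (no r∤k) = begin
    ℕ→ℚ (r ℕ.+ k) * S (r ℕ.+ k)
      ≡⟨ cong (ℕ→ℚ (r ℕ.+ k) *_)
              (substPow-nonmultiple r f (r ℕ.+ k) (λ r∣r+k → r∤k (∣m+n∣m⇒∣n r∣r+k ∣-refl))) ⟩
    ℕ→ℚ (r ℕ.+ k) * 0ℚ
      ≡⟨ vanish (ℕ→ℚ (r ℕ.+ k)) (ℕ→ℚ k) (ℕ→ℚ r * c) ⟩
    ℕ→ℚ k * 0ℚ + (ℕ→ℚ r * c) * 0ℚ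
      ≡⟨ cong (λ v → ℕ→ℚ k * v + (ℕ→ℚ r * c) * v) (substPow-nonmultiple r f k r∤k) ⟨
    ℕ→ℚ k * S k + (ℕ→ℚ r * c) * S k
      ∎
  by-divisibility .(q ℕ.* r) (yes (divides q refl)) = begin
    ℕ→ℚ (suc q ℕ.* r) * S (suc q ℕ.* r)
      ≡⟨ cong₂ _*_ (ℕ→ℚ-homo-* (suc q) r) (substPow-multiple r f (suc q)) ⟩
    ℕ→ℚ (suc q) * ℕ→ℚ r * f (suc q)
      ≡⟨ pull (ℕ→ℚ r) (ℕ→ℚ (suc q)) (f (suc q)) ⟩
    ℕ→ℚ r * (ℕ→ℚ (suc q) * f (suc q))
      ≡⟨ cong (ℕ→ℚ r *_) (ode q) ⟩
    ℕ→ℚ r * (ℕ→ℚ q * f q + c * f q)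
      ≡⟨ push (ℕ→ℚ r) (ℕ→ℚ q) (f q) c ⟩
    ℕ→ℚ q * ℕ→ℚ r * f q + (ℕ→ℚ r * c) * f q
      ≡⟨ cong₂ (λ u v → u * v + (ℕ→ℚ r * c) * v) (ℕ→ℚ-homo-* q r) (substPow-multiple r f q) ⟨
    ℕ→ℚ (q ℕ.* r) * S (q ℕ.* r) + (ℕ→ℚ r * c) * S (q ℕ.* r)
      ∎

-- Chain rule for u = t^r: (1 - u) f'(u) = c f(u) turns into (1 - t^r) S' = r c t^(r-1) S.
substPow-ode : ∀ m {f c} → deriv f ≗ euler f ⊕ c • f →
  deriv (substPow (suc m) f)
    ≗ shift (suc m) (deriv (substPow (suc m) f)) ⊕ (ℕ→ℚ (suc m) * c) • shift m (substPow (suc m) f)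
substPow-ode m {f} {c} ode n with n ℕₚ.<? m
... | yes n<m = begin
  ℕ→ℚ (suc n) * substPow (suc m) f (suc n)
    ≡⟨ cong (ℕ→ℚ (suc n) *_)
            (substPow-nonmultiple (suc m) f (suc n) (λ m+1∣n+1 → ℕₚ.<⇒≱ (s≤s n<m) (∣⇒≤ m+1∣n+1))) ⟩
  ℕ→ℚ (suc n) * 0ℚ
    ≡⟨ vanish (ℕ→ℚ (suc n)) (ℕ→ℚ (suc m) * c) ⟩
  0ℚ + (ℕ→ℚ (suc m) * c) * 0ℚ
    ≡⟨ cong₂ (λ u v → u + (ℕ→ℚ (suc m) * c) * v)
             (shift-< (suc m) _ n (ℕₚ.m≤n⇒m≤1+n n<m)) (shift-< m (substPow (suc m) f) n n<m) ⟨
  shift (suc m) (deriv (substPow (suc m) f)) n + (ℕ→ℚ (suc m) * c) * shift m (substPow (suc m) f) n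
    ∎
  where
  open ≡-Reasoning
  vanish : ∀ a b → a * 0ℚ ≡ 0ℚ + b * 0ℚ
  vanish = solve-∀ ℚ-ring
... | no n≮m with ℕₚ.m≤n⇒∃[o]m+o≡n (ℕₚ.≮⇒≥ n≮m)
...   | k , refl = begin
  ℕ→ℚ (suc m ℕ.+ k) * S (suc m ℕ.+ k)
    ≡⟨ substPow-coefficient (suc m) ode k ⟩
  ℕ→ℚ k * S k + (ℕ→ℚ (suc m) * c) * S k
    ≡⟨ cong₂ (λ u v → u + (ℕ→ℚ (suc m) * c) * v) shift-deriv (shift-+ m S k) ⟨
  shift (suc m) (deriv S) (m ℕ.+ k) + (ℕ→ℚ (suc m) * c) * shift m S (m ℕ.+ k)
    ∎
  where
  open ≡-Reasoning
  S : PS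
  S = substPow (suc m) f
  shift-deriv : shift (suc m) (deriv S) (m ℕ.+ k) ≡ ℕ→ℚ k * S k
  shift-deriv = begin
    shift (suc m) (deriv S) (m ℕ.+ k)     ≡⟨ shift-shift₁ m (deriv S) (m ℕ.+ k) ⟨
    shift m (shift₁ (deriv S)) (m ℕ.+ k)  ≡⟨ shift-+ m (shift₁ (deriv S)) k ⟩
    shift₁ (deriv S) k                    ≡⟨ shift₁-deriv S k ⟩
    ℕ→ℚ k * S k                           ∎

⋆-ode : ∀ m {f g a b} → deriv f ≗ shift m (deriv f) ⊕ a → deriv g ≗ shift m (deriv g) ⊕ b →
        deriv (f ⋆ g) ≗ shift m (deriv (f ⋆ g)) ⊕ (a ⋆ g ⊕ f ⋆ b)
⋆-ode m {f} {g} {a} {b} f-ode g-ode n = begin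
  deriv (f ⋆ g) n
    ≡⟨ deriv-⋆ f g n ⟩
  (deriv f ⋆ g) n + (f ⋆ deriv g) n
    ≡⟨ cong₂ _+_ (⋆-cong {g = g} f-ode (λ _ → refl) n) (⋆-cong {f = f} (λ _ → refl) g-ode n) ⟩
  ((shift m (deriv f) ⊕ a) ⋆ g) n + (f ⋆ (shift m (deriv g) ⊕ b)) n
    ≡⟨ cong₂ _+_ (⋆-distribʳ-⊕ (shift m (deriv f)) a g n) (⋆-distribˡ-⊕ f (shift m (deriv g)) b n) ⟩
  ((shift m (deriv f) ⋆ g) n + (a ⋆ g) n) + ((f ⋆ shift m (deriv g)) n + (f ⋆ b) n)
    ≡⟨ cong₂ (λ u v → (u + (a ⋆ g) n) + (v + (f ⋆ b) n))
             (⋆-shiftˡ m (deriv f) g n) (⋆-shiftʳ m f (deriv g) n) ⟩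
  (shift m (deriv f ⋆ g) n + (a ⋆ g) n) + (shift m (f ⋆ deriv g) n + (f ⋆ b) n)
    ≡⟨ interchange (shift m (deriv f ⋆ g) n) ((a ⋆ g) n) (shift m (f ⋆ deriv g) n) ((f ⋆ b) n) ⟩
  (shift m (deriv f ⋆ g) n + shift m (f ⋆ deriv g) n) + ((a ⋆ g) n + (f ⋆ b) n)
    ≡⟨ cong (_+ ((a ⋆ g) n + (f ⋆ b) n)) (begin
         shift m (deriv f ⋆ g) n + shift m (f ⋆ deriv g) n   ≡⟨ shift-⊕ m (deriv f ⋆ g) (f ⋆ deriv g) n ⟨
         shift m (deriv f ⋆ g ⊕ f ⋆ deriv g) n              ≡⟨ shift-cong m (deriv-⋆ f g) n ⟨
         shift m (deriv (f ⋆ g)) n                          ∎) ⟩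
  shift m (deriv (f ⋆ g)) n + ((a ⋆ g) n + (f ⋆ b) n)
    ∎
  where
  open ≡-Reasoning
  interchange : ∀ p q u v → (p + q) + (u + v) ≡ (p + u) + (q + v)
  interchange = solve-∀ ℚ-ring

-- The matrix A

entry-superdiagonal : ∀ r x y i → entry r x y i (suc i) ≡ - ℕ→ℚ i
entry-superdiagonal r x y i rewrite ⌊⌋-true (suc i ℕₚ.≟ suc i) refl = refl

entry-above : ∀ r x y i j → suc i ℕ.< j → entry r x y i j ≡ 0ℚ
entry-above r x y i j i+1<j
  rewrite ⌊⌋-false (j ℕₚ.≟ suc i) (λ j≡i+1 → ℕₚ.<-irrefl (sym j≡i+1) i+1<j)
        | ⌊⌋-false (j ℕₚ.≤? i) (ℕₚ.<⇒≱ (ℕₚ.<-trans (ℕₚ.n<1+n i) i+1<j))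
        | ⌊⌋-false (j ℕₚ.≟ i ℕ.+ 1 ℕ.∸ r)
            (λ j≡i+1∸r → ℕₚ.<⇒≱ i+1<j
               (ℕₚ.≤-trans (ℕₚ.≤-reflexive (trans j≡i+1∸r (cong (ℕ._∸ r) (ℕₚ.+-comm i 1))))
                           (ℕₚ.m∸n≤m (suc i) r)))
        | ∧-zeroʳ ⌊ r ℕₚ.≤? i ⌋
        = refl

entry-band : ∀ r x y j k → k ≤ r ℕ.∸ 2 → entry r x y (suc (j ℕ.+ k)) (suc j) ≡ x
entry-band r x y j k k≤r-2
  rewrite ⌊⌋-false (suc j ℕₚ.≟ suc (suc (j ℕ.+ k)))
            (λ eq → ℕₚ.<-irrefl (ℕₚ.suc-injective eq) (s≤s (ℕₚ.m≤m+n j k)))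
        | ⌊⌋-true (suc j ℕₚ.≤? suc (j ℕ.+ k)) (s≤s (ℕₚ.m≤m+n j k))
        | ⌊⌋-true (suc (j ℕ.+ k) ℕₚ.≤? suc j ℕ.+ (r ℕ.∸ 2)) (s≤s (ℕₚ.+-monoʳ-≤ j k≤r-2))
        = refl

corner-row+1 : ∀ j s → suc (j ℕ.+ suc s) ℕ.+ 1 ≡ suc j ℕ.+ suc (suc s)
corner-row+1 = ℕ-Solver.solve-∀

below-row+1 : ∀ j s t → suc (j ℕ.+ (suc (suc s) ℕ.+ t)) ℕ.+ 1 ≡ suc (suc (j ℕ.+ t)) ℕ.+ suc (suc s)
below-row+1 = ℕ-Solver.solve-∀

entry-corner : ∀ s x y j → entry (suc (suc s)) x y (suc (j ℕ.+ suc s)) (suc j) ≡ y + ℕ→ℚ j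
entry-corner s x y j
  rewrite ⌊⌋-false (suc j ℕₚ.≟ suc (suc (j ℕ.+ suc s)))
            (λ eq → ℕₚ.<-irrefl (ℕₚ.suc-injective eq) (s≤s (ℕₚ.m≤m+n j (suc s))))
        | ⌊⌋-false (suc (j ℕ.+ suc s) ℕₚ.≤? suc j ℕ.+ s)
            (λ le → ℕₚ.<-irrefl refl (ℕₚ.≤-trans (ℕₚ.≤-reflexive (sym (ℕₚ.+-suc j s))) (ℕₚ.≤-pred le)))
        | ∧-zeroʳ ⌊ suc j ℕₚ.≤? suc (j ℕ.+ suc s) ⌋
        | ⌊⌋-true (suc (suc s) ℕₚ.≤? suc (j ℕ.+ suc s)) (s≤s (ℕₚ.m≤n+m (suc s) j))
        | ⌊⌋-true (suc j ℕₚ.≟ suc (j ℕ.+ suc s) ℕ.+ 1 ℕ.∸ suc (suc s))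
            (sym (trans (cong (ℕ._∸ suc (suc s)) (corner-row+1 j s)) (ℕₚ.m+n∸n≡m (suc j) (suc (suc s)))))
        = begin
  y + ℕ→ℚ (suc (j ℕ.+ suc s)) - ℕ→ℚ (suc (suc s))
    ≡⟨ cong (λ i → y + ℕ→ℚ i - ℕ→ℚ (suc (suc s))) (ℕₚ.+-suc j (suc s)) ⟨
  y + ℕ→ℚ (j ℕ.+ suc (suc s)) - ℕ→ℚ (suc (suc s))
    ≡⟨ cong (λ q → y + q - ℕ→ℚ (suc (suc s))) (ℕ→ℚ-homo-+ j (suc (suc s))) ⟩
  y + (ℕ→ℚ j + ℕ→ℚ (suc (suc s))) - ℕ→ℚ (suc (suc s))
    ≡⟨ cancel y (ℕ→ℚ j) (ℕ→ℚ (suc (suc s))) ⟩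
  y + ℕ→ℚ j
    ∎
  where
  open ≡-Reasoning
  cancel : ∀ y a b → y + (a + b) - b ≡ y + a
  cancel = solve-∀ ℚ-ring

entry-below : ∀ s x y j t → entry (suc (suc s)) x y (suc (j ℕ.+ (suc (suc s) ℕ.+ t))) (suc j) ≡ 0ℚ
entry-below s x y j t
  rewrite ⌊⌋-false (suc j ℕₚ.≟ suc (suc (j ℕ.+ (suc (suc s) ℕ.+ t))))
            (λ eq → ℕₚ.<-irrefl (ℕₚ.suc-injective eq) (s≤s (ℕₚ.m≤m+n j (suc (suc s) ℕ.+ t))))
        | ⌊⌋-false (suc (j ℕ.+ (suc (suc s) ℕ.+ t)) ℕₚ.≤? suc j ℕ.+ s)
            (λ le → ℕₚ.<⇒≱ (ℕₚ.+-monoʳ-< j (s≤s (ℕₚ.≤-trans (ℕₚ.n≤1+n s) (ℕₚ.m≤m+n (suc s) t))))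
                           (ℕₚ.≤-pred le))
        | ∧-zeroʳ ⌊ suc j ℕₚ.≤? suc (j ℕ.+ (suc (suc s) ℕ.+ t)) ⌋
        | ⌊⌋-false (suc j ℕₚ.≟ suc (j ℕ.+ (suc (suc s) ℕ.+ t)) ℕ.+ 1 ℕ.∸ suc (suc s))
            (λ eq → ℕₚ.<-irrefl (ℕₚ.suc-injective (trans eq (trans (cong (ℕ._∸ suc (suc s)) (below-row+1 j s t))
                                                                  (ℕₚ.m+n∸n≡m _ (suc (suc s))))))
                                (s≤s (ℕₚ.m≤m+n j t)))
        | ∧-zeroʳ ⌊ suc (suc s) ℕₚ.≤? suc (j ℕ.+ (suc (suc s) ℕ.+ t)) ⌋
        = refl

entry-lower : ∀ s x y j k → entry (suc (suc s)) x y (suc (j ℕ.+ k)) (suc j)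
                              ≡ x * geometric (suc (suc s)) k + (y - x + ℕ→ℚ j) * monomial (suc s) k
entry-lower s x y j k with ℕₚ.<-cmp k (suc s)
... | tri< k<s+1 _ _ = begin
  entry (suc (suc s)) x y (suc (j ℕ.+ k)) (suc j)
    ≡⟨ entry-band (suc (suc s)) x y j k (ℕₚ.≤-pred k<s+1) ⟩
  x
    ≡⟨ simplify x (y - x + ℕ→ℚ j) ⟨
  x * 1ℚ + (y - x + ℕ→ℚ j) * 0ℚ
    ≡⟨ cong₂ (λ g m → x * g + (y - x + ℕ→ℚ j) * m)
             (geometric-< (suc (suc s)) k (ℕₚ.m≤n⇒m≤1+n k<s+1))
             (monomial-offDiagonal (suc s) k (ℕₚ.<⇒≢ k<s+1)) ⟨
  x * geometric (suc (suc s)) k + (y - x + ℕ→ℚ j) * monomial (suc s) k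
    ∎
  where
  open ≡-Reasoning
  simplify : ∀ a b → a * 1ℚ + b * 0ℚ ≡ a
  simplify = solve-∀ ℚ-ring
... | tri≈ _ refl _ = begin
  entry (suc (suc s)) x y (suc (j ℕ.+ suc s)) (suc j)
    ≡⟨ entry-corner s x y j ⟩
  y + ℕ→ℚ j
    ≡⟨ simplify x y (ℕ→ℚ j) ⟨
  x * 1ℚ + (y - x + ℕ→ℚ j) * 1ℚ
    ≡⟨ cong₂ (λ g m → x * g + (y - x + ℕ→ℚ j) * m)
             (geometric-< (suc (suc s)) (suc s) ℕₚ.≤-refl) (monomial-diagonal (suc s)) ⟨
  x * geometric (suc (suc s)) (suc s) + (y - x + ℕ→ℚ j) * monomial (suc s) (suc s)
    ∎
  where
  open ≡-Reasoning
  simplify : ∀ x y a → x * 1ℚ + (y - x + a) * 1ℚ ≡ y + a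
  simplify = solve-∀ ℚ-ring
... | tri> _ _ s+1<k with ℕₚ.m≤n⇒∃[o]m+o≡n s+1<k
...   | t , refl = begin
  entry (suc (suc s)) x y (suc (j ℕ.+ (suc (suc s) ℕ.+ t))) (suc j)
    ≡⟨ entry-below s x y j t ⟩
  0ℚ
    ≡⟨ simplify x (y - x + ℕ→ℚ j) ⟨
  x * 0ℚ + (y - x + ℕ→ℚ j) * 0ℚ
    ≡⟨ cong₂ (λ g m → x * g + (y - x + ℕ→ℚ j) * m)
             (geometric-≥ (suc (suc s)) (suc (suc s) ℕ.+ t) (ℕₚ.m≤m+n (suc (suc s)) t))
             (monomial-offDiagonal (suc s) (suc (suc s) ℕ.+ t)
                (λ eq → ℕₚ.<-irrefl (sym eq) (s≤s (s≤s (ℕₚ.m≤m+n s t))))) ⟨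
  x * geometric (suc (suc s)) (suc (suc s) ℕ.+ t) + (y - x + ℕ→ℚ j) * monomial (suc s) (suc (suc s) ℕ.+ t)
    ∎
  where
  open ≡-Reasoning
  simplify : ∀ a b → a * 0ℚ + b * 0ℚ ≡ 0ℚ
  simplify = solve-∀ ℚ-ring

A∞ : ℕ → ℚ → ℚ → Matrix
A∞ r x y i j = entry r x y (suc i) (suc j)

V≡leadingMinor : ∀ r n x y → V r n x y ≡ leadingMinor (A∞ r x y) n
V≡leadingMinor r zero    x y = refl
V≡leadingMinor r (suc n) x y = refl

A∞-lowerHessenberg : ∀ r x y → IsLowerHessenberg (A∞ r x y)
A∞-lowerHessenberg r x y i j i+1<j = entry-above r x y (suc i) (suc j) (s≤s i+1<j)

A∞-superdiagonal : ∀ r x y k → A∞ r x y k (suc k) ≡ - ℕ→ℚ (suc k)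
A∞-superdiagonal r x y k = entry-superdiagonal r x y (suc k)

A∞-rowSum : ∀ s x y f n →
  sumFin (suc n) (λ j → A∞ (suc (suc s)) x y n (toℕ j) * f (toℕ j))
    ≡ x * (f ⋆ geometric (suc (suc s))) n + shift (suc s) ((y - x) • f ⊕ euler f) n
A∞-rowSum s x y f n = begin
  sumFin (suc n) (λ j → A∞ r x y n (toℕ j) * f (toℕ j))
    ≡⟨ sumFin-cong (suc n) summand ⟩
  sumFin (suc n) (λ j → ⋆-summand f (x • geometric r) n j + ⋆-summand K (monomial (suc s)) n j)
    ≡⟨ sumFin-+ (suc n) (⋆-summand f (x • geometric r) n) (⋆-summand K (monomial (suc s)) n) ⟩
  (f ⋆ (x • geometric r)) n + (K ⋆ monomial (suc s)) n
    ≡⟨ cong₂ _+_ (⋆-•ʳ x f (geometric r) n) (⋆-monomialʳ (suc s) K n) ⟩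
  x * (f ⋆ geometric r) n + shift (suc s) K n
    ∎
  where
  open ≡-Reasoning
  r : ℕ
  r = suc (suc s)
  K : PS
  K = (y - x) • f ⊕ euler f
  distribute : ∀ x y q j φ μ → (x * q + (y - x + j) * μ) * φ ≡ φ * (x * q) + ((y - x) * φ + j * φ) * μ
  distribute = solve-∀ ℚ-ring
  summand : ∀ (j : Fin (suc n)) →
    A∞ r x y n (toℕ j) * f (toℕ j) ≡ ⋆-summand f (x • geometric r) n j + ⋆-summand K (monomial (suc s)) n j
  summand j = begin
    entry r x y (suc n) (suc (toℕ j)) * f (toℕ j)
      ≡⟨ cong (λ i → entry r x y (suc i) (suc (toℕ j)) * f (toℕ j)) (ℕₚ.m+[n∸m]≡n (toℕ≤pred[n] j)) ⟨
    entry r x y (suc (toℕ j ℕ.+ (n ℕ.∸ toℕ j))) (suc (toℕ j)) * f (toℕ j)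
      ≡⟨ cong (_* f (toℕ j)) (entry-lower s x y (toℕ j) (n ℕ.∸ toℕ j)) ⟩
    (x * geometric r (n ℕ.∸ toℕ j) + (y - x + ℕ→ℚ (toℕ j)) * monomial (suc s) (n ℕ.∸ toℕ j)) * f (toℕ j)
      ≡⟨ distribute x y (geometric r (n ℕ.∸ toℕ j)) (ℕ→ℚ (toℕ j)) (f (toℕ j))
                    (monomial (suc s) (n ℕ.∸ toℕ j)) ⟩
    ⋆-summand f (x • geometric r) n j + ⋆-summand K (monomial (suc s)) n j
      ∎

egfSolution : (r : ℕ) .{{_ : NonZero r}} → ℚ → ℚ → PS
egfSolution r x y = substPow r (oneMinusPow ((x - y) * (+ 1 / r))) ⋆ oneMinusPow (- x)

egfSolution-zero : ∀ r .{{_ : NonZero r}} x y → egfSolution r x y 0 ≡ 1ℚ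
egfSolution-zero r x y =
  cong (λ u → u * oneMinusPow (- x) 0 + 0ℚ) (substPow-multiple r (oneMinusPow ((x - y) * (+ 1 / r))) 0)

egfSolution-ode : ∀ m x y →
  deriv (egfSolution (suc m) x y)
    ≗ shift (suc m) (deriv (egfSolution (suc m) x y))
      ⊕ ((y - x) • shift m (egfSolution (suc m) x y) ⊕ x • (egfSolution (suc m) x y ⋆ geometric (suc m)))
egfSolution-ode m x y n = begin
  deriv H n
    ≡⟨ ⋆-ode r {S} {G} S-ode G-ode n ⟩
  shift r (deriv H) n + ((((y - x) • shift m S) ⋆ G) n + (S ⋆ (x • (G ⋆ geometric r))) n)
    ≡⟨ cong (_+_ (shift r (deriv H) n)) (cong₂ _+_ first second) ⟩
  shift r (deriv H) n + ((y - x) * shift m H n + x * (H ⋆ geometric r) n)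
    ∎
  where
  open ≡-Reasoning
  r : ℕ
  r = suc m
  a : ℚ
  a = (x - y) * (+ 1 / r)
  S G H : PS
  S = substPow r (oneMinusPow a)
  G = oneMinusPow (- x)
  H = S ⋆ G
  negate : ∀ a b → - (a - b) ≡ b - a
  negate = solve-∀ ℚ-ring
  neg-involutive : ∀ a → - (- a) ≡ a
  neg-involutive = solve-∀ ℚ-ring
  push : ∀ a b → a * (- b) ≡ - (a * b)
  push = solve-∀ ℚ-ring
  coefficient : ℕ→ℚ r * (- a) ≡ y - x
  coefficient = trans (push (ℕ→ℚ r) a) (trans (cong -_ (ℕ→ℚ-*-cancel m (x - y))) (negate x y))
  S-ode : deriv S ≗ shift r (deriv S) ⊕ (y - x) • shift m S
  S-ode n = trans (substPow-ode m {oneMinusPow a} { - a } (oneMinusPow-ode a) n)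
                  (cong (λ c → shift r (deriv S) n + c * shift m S n) coefficient)
  G-ode : deriv G ≗ shift r (deriv G) ⊕ x • (G ⋆ geometric r)
  G-ode = ode-telescope {G} {x}
            (λ n → trans (oneMinusPow-ode (- x) n) (cong (λ c → euler G n + c * G n) (neg-involutive x))) r
  first : (((y - x) • shift m S) ⋆ G) n ≡ (y - x) * shift m H n
  first = trans (⋆-•ˡ (y - x) (shift m S) G n) (cong ((y - x) *_) (⋆-shiftˡ m S G n))
  second : (S ⋆ (x • (G ⋆ geometric r))) n ≡ x * (H ⋆ geometric r) n
  second = trans (⋆-•ʳ x S (G ⋆ geometric r) n) (cong (x *_) (sym (⋆-assoc S G (geometric r) n)))

egfSolution-recurrence : ∀ s x y → SatisfiesRecurrence (A∞ (suc (suc s)) x y) (egfSolution (suc (suc s)) x y)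
egfSolution-recurrence s x y n = begin
  deriv H n
    ≡⟨ egfSolution-ode (suc s) x y n ⟩
  shift r (deriv H) n + ((y - x) * shift (suc s) H n + x * (H ⋆ geometric r) n)
    ≡⟨ cong (_+ ((y - x) * shift (suc s) H n + x * (H ⋆ geometric r) n)) shift-deriv ⟩
  shift (suc s) (euler H) n + ((y - x) * shift (suc s) H n + x * (H ⋆ geometric r) n)
    ≡⟨ rotate (shift (suc s) (euler H) n) ((y - x) * shift (suc s) H n) (x * (H ⋆ geometric r) n) ⟩
  x * (H ⋆ geometric r) n + ((y - x) * shift (suc s) H n + shift (suc s) (euler H) n)
    ≡⟨ cong (_+_ (x * (H ⋆ geometric r) n)) (begin
         (y - x) * shift (suc s) H n + shift (suc s) (euler H) n
           ≡⟨ cong (_+ shift (suc s) (euler H) n) (shift-• (suc s) (y - x) H n) ⟨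
         shift (suc s) ((y - x) • H) n + shift (suc s) (euler H) n
           ≡⟨ shift-⊕ (suc s) ((y - x) • H) (euler H) n ⟨
         shift (suc s) ((y - x) • H ⊕ euler H) n
           ∎) ⟩
  x * (H ⋆ geometric r) n + shift (suc s) ((y - x) • H ⊕ euler H) n
    ≡⟨ A∞-rowSum s x y H n ⟨
  sumFin (suc n) (λ j → A∞ r x y n (toℕ j) * H (toℕ j))
    ∎
  where
  open ≡-Reasoning
  r : ℕ
  r = suc (suc s)
  H : PS
  H = egfSolution r x y
  shift-deriv : shift r (deriv H) n ≡ shift (suc s) (euler H) n
  shift-deriv = trans (sym (shift-shift₁ (suc s) (deriv H) n)) (shift-cong (suc s) (shift₁-deriv H) n)
  rotate : ∀ a b c → a + (b + c) ≡ c + (b + a)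
  rotate = solve-∀ ℚ-ring

theorem2p3 : (r : ℕ) → .{{_ : NonZero r}} → 2 ≤ r → (x y : ℚ) → (n : ℕ) →
    egf (λ m → V r m x y) n
      ≡ (substPow r (oneMinusPow ((x - y) * (+ 1 / r))) ⋆ oneMinusPow (- x)) n
theorem2p3 (suc (suc s)) _ x y n = begin
  V r n x y * invFact n
    ≡⟨ cong (_* invFact n) (V≡leadingMinor r n x y) ⟩
  minors n
    ≡⟨ recurrence-unique (A∞ r x y) minors (egfSolution r x y)
         minors-recurrence (egfSolution-recurrence s x y) (sym (egfSolution-zero r x y)) n ⟩
  egfSolution r x y n
    ∎
  where
  open ≡-Reasoning
  r : ℕ
  r = suc (suc s)
  minors : PS
  minors m = leadingMinor (A∞ r x y) m * invFact m
  minors-recurrence : SatisfiesRecurrence (A∞ r x y) minors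
  minors-recurrence = leadingMinor-egf-recurrence (A∞ r x y) (A∞-lowerHessenberg r x y) (A∞-superdiagonal r x y)
theorem2p3 (suc zero) (s≤s ())
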